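{- Fix $h,k>0$ and a partition $\mu$. For any nonempty $P\subseteq\mathcal{P}(h,k)$, $$\bigcap_{\alpha\in P}\mathcal{Q}(\mu+\alpha)=\mathcal{Q}(\vee_P(\mu)).$$
   Context: A partition is a weakly decreasing sequence of nonnegative integers with finitely many positive terms; height = number of positive parts, width $w_\beta=\beta_1$. $\mathcal{P}(h,k)$ is the (finite) set of partitions of height at most $h$ and width exactly $k$. Sum: $\mu+\alpha=(\mu_1+\alpha_1,\mu_2+\alpha_2,\ldots)$. $\mathcal{Q}(\beta)$ is the set of partitions obtained from $\beta$ by adding any finite number of parts each at most $w_\beta$. For partitions $\alpha=(p^{m_p},\ldots,1^{m_1})$ and $\beta=(p^{n_p},\ldots,1^{n_1})$ written with multiplicities $m_i,n_i\ge0$ of the positive parts, $\alpha\vee\beta=(p^{e_p},\ldots,1^{e_1})$ with $e_i=\max(m_i,n_i)$. For a nonempty finite set $P=\{\alpha^{(1)},\ldots,\alpha^{(s)}\}$ of partitions, $\vee_P(\mu)=(\mu+\alpha^{(1)})\vee\cdots\vee(\mu+\alpha^{(s)})$. -}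

module Defs where

open import Data.Nat using (ℕ; zero; suc; _+_; _≤_; _<_; _⊔_; _≟_)
open import Data.List using (List; []; _∷_; _++_; length; filter; replicate; concat; map; downFrom; foldr)
open import Data.List.Relation.Unary.All using (All)
open import Data.List.Relation.Unary.Linked using (Linked)
open import Data.List.Relation.Binary.Permutation.Propositional using (_↭_)
open import Data.Product using (Σ; _×_)
open import Relation.Binary.PropositionalEquality using (_≡_)

-- A partition is represented by the list of its positive parts,
-- in weakly decreasing order (trailing zeros omitted).
IsPartition : List ℕ → Set
IsPartition xs = All (0 <_) xs × Linked (λ a b → b ≤ a) xs

width : List ℕ → ℕ
width []      = 0
width (x ∷ _) = x

height : List ℕ → ℕ
height = length

_⊕_ : List ℕ → List ℕ → List ℕ
[]       ⊕ ys       = ys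
(x ∷ xs) ⊕ []       = x ∷ xs
(x ∷ xs) ⊕ (y ∷ ys) = (x + y) ∷ (xs ⊕ ys)

mult : ℕ → List ℕ → ℕ
mult i β = length (filter (_≟ i) β)

-- α ∨ β = (p^{e_p}, …, 1^{e_1}) with e_i = max(m_i, n_i), p = max width
_∨_ : List ℕ → List ℕ → List ℕ
α ∨ β = concat (map (λ i → replicate (mult i α ⊔ mult i β) i)
                    (map suc (downFrom (width α ⊔ width β))))

InP : ℕ → ℕ → List ℕ → Set
InP h k α = IsPartition α × height α ≤ h × width α ≡ k

InQ : List ℕ → List ℕ → Set
InQ β γ = IsPartition γ × Σ (List ℕ) (λ L → All (λ x → 0 < x × x ≤ width β) L × γ ↭ (β ++ L))

-- ∨_P(μ) for a nonempty P = α ∷ αs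
veeP : List ℕ → List ℕ → List (List ℕ) → List ℕ
veeP μ α αs = foldr (λ β acc → (μ ⊕ β) ∨ acc) (μ ⊕ α) αs

module Submission where

-- For a list β whose parts all lie in 1..w, membership
-- γ ∈ 𝒬(β) means: γ is a partition, every part of γ lies in 1..w, and γ
-- contains β as a sub-multiset (mult i β ≤ mult i γ for every i).  When
-- all the β = μ + α (α ∈ P) share the width w = w_μ + k, the intersection
-- of the 𝒬(μ + α) is therefore described by the pointwise maximum of the
-- multiplicities, which is exactly the multiplicity function of ∨_P(μ);
-- and ∨_P(μ) itself has width w.

open import Defs
open import Data.Nat using (ℕ; zero; suc; _+_; _≤_; _<_; _⊔_; _≟_; _≤?_; _<?_; z≤n; s≤s; s≤s⁻¹)
open import Data.Nat.Properties
open import Data.List using (List; []; _∷_; _++_; length; filter; replicate; concat; map; downFrom)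
open import Data.List.Properties using (filter-accept; filter-reject; filter-++; filter-all; filter-none; length-++; length-replicate)
open import Data.List.Relation.Unary.All as All using (All; []; _∷_)
open import Data.List.Relation.Unary.All.Properties using (++⁺; ++⁻ʳ; replicate⁺)
open import Data.List.Relation.Unary.Linked using (Linked; [-]; _∷_)
open import Data.List.Relation.Binary.Permutation.Propositional using (_↭_; ↭-refl; ↭-prep; ↭-swap; ↭-trans; ↭-sym)
open import Data.List.Relation.Binary.Permutation.Propositional.Properties using (All-resp-↭; ↭-length; filter-↭)
open import Data.Product using (∃; _×_; _,_; proj₁; proj₂)
open import Data.Sum as Sum using (_⊎_; inj₁; inj₂)
open import Data.Empty using (⊥-elim)
open import Relation.Nullary using (¬_; yes; no; _×-dec_)
open import Relation.Binary.PropositionalEquality using (_≡_; refl; sym; trans; cong; cong₂; subst; subst₂; module ≡-Reasoning)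
open import Function.Bundles using (_⇔_; mk⇔; Equivalence)

mult-∷-≡ : ∀ {i x} (xs : List ℕ) → x ≡ i → mult i (x ∷ xs) ≡ suc (mult i xs)
mult-∷-≡ {i} xs x≡i = cong length (filter-accept (_≟ i) x≡i)

mult-∷-≢ : ∀ {i x} (xs : List ℕ) → ¬ x ≡ i → mult i (x ∷ xs) ≡ mult i xs
mult-∷-≢ {i} xs x≢i = cong length (filter-reject (_≟ i) x≢i)

mult-++ : ∀ i (xs ys : List ℕ) → mult i (xs ++ ys) ≡ mult i xs + mult i ys
mult-++ i xs ys =
  trans (cong length (filter-++ (_≟ i) xs ys)) (length-++ (filter (_≟ i) xs))

mult-↭ : ∀ i {xs ys : List ℕ} → xs ↭ ys → mult i xs ≡ mult i ys
mult-↭ i xs↭ys = ↭-length (filter-↭ (_≟ i) xs↭ys)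

mult-replicate : ∀ i m → mult i (replicate m i) ≡ m
mult-replicate i m =
  trans (cong length (filter-all (_≟ i) (replicate⁺ m refl))) (length-replicate m)

mult-absent : ∀ i (xs : List ℕ) → All (λ x → ¬ x ≡ i) xs → mult i xs ≡ 0
mult-absent i xs none = cong length (filter-none (_≟ i) none)

_⊑_ : List ℕ → List ℕ → Set
xs ⊑ ys = ∀ i → mult i xs ≤ mult i ys

pull-out : ∀ b (γ : List ℕ) → 0 < mult b γ → ∃ λ γ' → γ ↭ b ∷ γ'
pull-out b (x ∷ γ) b∈ with x ≟ b
... | yes refl = γ , ↭-refl
... | no x≢b with pull-out b γ (subst (0 <_) (mult-∷-≢ γ x≢b) b∈)
...   | γ' , γ↭ = x ∷ γ' , ↭-trans (↭-prep x γ↭) (↭-swap x b ↭-refl)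

⊑⇒complement : ∀ (xs ys : List ℕ) → xs ⊑ ys → ∃ λ L → ys ↭ xs ++ L
⊑⇒complement []       ys _     = ys , ↭-refl
⊑⇒complement (b ∷ xs) ys b∷xs⊑ys
  with pull-out b ys (≤-trans (s≤s z≤n) (subst (_≤ mult b ys) (mult-∷-≡ {b} xs refl) (b∷xs⊑ys b)))
... | ys' , ys↭ with ⊑⇒complement xs ys' xs⊑ys'
  where
  xs⊑ys' : xs ⊑ ys'
  xs⊑ys' i with b ≟ i
  ... | yes b≡i = s≤s⁻¹ (subst₂ _≤_ (mult-∷-≡ xs b≡i) (trans (mult-↭ i ys↭) (mult-∷-≡ ys' b≡i)) (b∷xs⊑ys i))
  ... | no b≢i  = subst₂ _≤_ (mult-∷-≢ xs b≢i) (trans (mult-↭ i ys↭) (mult-∷-≢ ys' b≢i)) (b∷xs⊑ys i)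
...   | L , ys'↭ = L , ↭-trans ys↭ (↭-prep b ys'↭)

complement⇒⊑ : ∀ {xs ys L : List ℕ} → ys ↭ xs ++ L → xs ⊑ ys
complement⇒⊑ {xs} {ys} {L} ys↭ i =
  subst (mult i xs ≤_) (sym (trans (mult-↭ i ys↭) (mult-++ i xs L))) (m≤m+n _ _)

Bounded : ℕ → List ℕ → Set
Bounded w = All (λ x → 0 < x × x ≤ w)

bounded-weaken : ∀ {w w'} {xs : List ℕ} → w ≤ w' → Bounded w xs → Bounded w' xs
bounded-weaken w≤w' = All.map (λ (0<x , x≤w) → 0<x , ≤-trans x≤w w≤w')

WidthBounded : List ℕ → Set
WidthBounded x = Bounded (width x) x

mult-out-of-range : ∀ {w i} {xs : List ℕ} → Bounded w xs → ¬ (0 < i × i ≤ w) → mult i xs ≡ 0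
mult-out-of-range {xs = xs} bounded out =
  mult-absent _ xs (All.map (λ { x-in refl → out x-in }) bounded)

InQ⇔ : ∀ {w} {β γ : List ℕ} → width β ≡ w → WidthBounded β →
  InQ β γ ⇔ (IsPartition γ × β ⊑ γ × Bounded w γ)
InQ⇔ {β = β} {γ} refl bβ = mk⇔ forward backward
  where
  forward : InQ β γ → IsPartition γ × β ⊑ γ × Bounded (width β) γ
  forward (pγ , L , bL , γ↭) =
    pγ , complement⇒⊑ {β} γ↭ , All-resp-↭ (↭-sym γ↭) (++⁺ bβ bL)
  backward : IsPartition γ × β ⊑ γ × Bounded (width β) γ → InQ β γ
  backward (pγ , β⊑γ , bγ) with ⊑⇒complement β γ β⊑γ
  ... | L , γ↭ = pγ , L , ++⁻ʳ β (All-resp-↭ γ↭ bγ) , γ↭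

-- Blocks.  block f n = (n^{f n}, …, 1^{f 1}); by definition of ∨,
-- x ∨ y = block (λ i → mult i x ⊔ mult i y) (w_x ⊔ w_y).

block : (ℕ → ℕ) → ℕ → List ℕ
block f n = concat (map (λ i → replicate (f i) i) (map suc (downFrom n)))

block-bounded : ∀ f n → Bounded n (block f n)
block-bounded f zero    = []
block-bounded f (suc n) =
  ++⁺ (replicate⁺ (f (suc n)) (s≤s z≤n , ≤-refl)) (bounded-weaken (n≤1+n n) (block-bounded f n))

block-mult : ∀ f n i → 0 < i → i ≤ n → mult i (block f n) ≡ f i
block-mult f zero    i 0<i i≤0 = ⊥-elim (<⇒≱ 0<i i≤0)
block-mult f (suc n) i 0<i i≤1+n with i ≟ suc n
... | yes refl = begin
  mult i (replicate (f i) i ++ block f n)       ≡⟨ mult-++ i (replicate (f i) i) (block f n) ⟩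
  mult i (replicate (f i) i) + mult i (block f n)
    ≡⟨ cong₂ _+_ (mult-replicate i (f i)) (mult-out-of-range (block-bounded f n) (λ (_ , i≤n) → 1+n≰n i≤n)) ⟩
  f i + 0                                       ≡⟨ +-identityʳ (f i) ⟩
  f i                                           ∎
  where open ≡-Reasoning
... | no i≢1+n = begin
  mult i (replicate (f (suc n)) (suc n) ++ block f n)
    ≡⟨ mult-++ i (replicate (f (suc n)) (suc n)) (block f n) ⟩
  mult i (replicate (f (suc n)) (suc n)) + mult i (block f n)
    ≡⟨ cong₂ _+_ (mult-absent i _ (replicate⁺ (f (suc n)) (λ 1+n≡i → i≢1+n (sym 1+n≡i))))
                 (block-mult f n i 0<i (s≤s⁻¹ (≤∧≢⇒< i≤1+n i≢1+n))) ⟩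
  f i                                           ∎
  where open ≡-Reasoning

block-width : ∀ f n → n ≡ 0 ⊎ 0 < f n → width (block f n) ≡ n
block-width f zero    _             = refl
block-width f (suc n) (inj₂ 0<fn) with f (suc n)
... | suc _ = refl

width-occurs : ∀ (x : List ℕ) {n} → width x ≡ n → n ≡ 0 ⊎ 0 < mult n x
width-occurs []      refl = inj₁ refl
width-occurs (a ∷ x) refl = inj₂ (subst (0 <_) (sym (mult-∷-≡ {a} x refl)) (s≤s z≤n))

∨-width : ∀ (x y : List ℕ) → width (x ∨ y) ≡ width x ⊔ width y
∨-width x y with ⊔-sel (width x) (width y)
... | inj₁ top≡wx = block-width _ _
  (Sum.map₂ (λ occ → ≤-trans occ (m≤m⊔n _ _)) (width-occurs x (sym top≡wx)))
... | inj₂ top≡wy = block-width _ _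
  (Sum.map₂ (λ occ → ≤-trans occ (m≤n⊔m _ _)) (width-occurs y (sym top≡wy)))

∨-bounded : ∀ (x y : List ℕ) → WidthBounded (x ∨ y)
∨-bounded x y = subst (λ w → Bounded w (x ∨ y)) (sym (∨-width x y)) (block-bounded _ _)

∨-mult : ∀ {x y : List ℕ} → WidthBounded x → WidthBounded y →
  ∀ i → mult i (x ∨ y) ≡ mult i x ⊔ mult i y
∨-mult {x} {y} bx by i with (0 <? i) ×-dec (i ≤? width x ⊔ width y)
... | yes (0<i , i≤w) = block-mult _ _ i 0<i i≤w
... | no out = trans (mult-out-of-range (block-bounded _ _) out)
  (sym (cong₂ _⊔_ (mult-out-of-range (bounded-weaken (m≤m⊔n _ _) bx) out)
                   (mult-out-of-range (bounded-weaken (m≤n⊔m _ _) by) out)))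

∨-⊑ : ∀ {x y γ : List ℕ} → WidthBounded x → WidthBounded y →
  (x ∨ y) ⊑ γ ⇔ (x ⊑ γ × y ⊑ γ)
∨-⊑ {x} {y} {γ} bx by = mk⇔
  (λ x∨y⊑γ → (λ i → ≤-trans (m≤m⊔n _ _) (join≤ i x∨y⊑γ)) , (λ i → ≤-trans (m≤n⊔m _ _) (join≤ i x∨y⊑γ)))
  (λ (x⊑γ , y⊑γ) i → subst (_≤ mult i γ) (sym (∨-mult bx by i)) (⊔-lub (x⊑γ i) (y⊑γ i)))
  where
  join≤ : ∀ i → (x ∨ y) ⊑ γ → mult i x ⊔ mult i y ≤ mult i γ
  join≤ i x∨y⊑γ = subst (_≤ mult i γ) (∨-mult bx by i) (x∨y⊑γ i)

partition-widthBounded : ∀ {xs : List ℕ} → IsPartition xs → WidthBounded xs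
partition-widthBounded {[]}     _            = []
partition-widthBounded {x ∷ xs} (pos , dec) = All.zip (pos , below-head dec)
  where
  below-head : ∀ {y ys} → Linked (λ a b → b ≤ a) (y ∷ ys) → All (_≤ y) (y ∷ ys)
  below-head [-]          = ≤-refl ∷ []
  below-head (y≥z ∷ rest) = ≤-refl ∷ All.map (λ t → ≤-trans t y≥z) (below-head rest)

⊕-width : ∀ (xs ys : List ℕ) → width (xs ⊕ ys) ≡ width xs + width ys
⊕-width []       ys       = refl
⊕-width (x ∷ xs) []       = sym (+-identityʳ x)
⊕-width (x ∷ xs) (y ∷ ys) = refl

⊕-bounded : ∀ {a b} (xs ys : List ℕ) → Bounded a xs → Bounded b ys → Bounded (a + b) (xs ⊕ ys)
⊕-bounded []       ys       []  bys = bounded-weaken (m≤n+m _ _) bys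
⊕-bounded (x ∷ xs) []       bxs []  = bounded-weaken (m≤m+n _ _) bxs
⊕-bounded (x ∷ xs) (y ∷ ys) ((0<x , x≤a) ∷ bxs) ((_ , y≤b) ∷ bys) =
  (≤-trans 0<x (m≤m+n x y) , +-mono-≤ x≤a y≤b) ∷ ⊕-bounded xs ys bxs bys

⊕-widthBounded : ∀ {μ β : List ℕ} → IsPartition μ → IsPartition β → WidthBounded (μ ⊕ β)
⊕-widthBounded {μ} {β} pμ pβ =
  subst (λ w → Bounded w (μ ⊕ β)) (sym (⊕-width μ β))
        (⊕-bounded μ β (partition-widthBounded pμ) (partition-widthBounded pβ))

veeP-width : ∀ {w} (μ α : List ℕ) (αs : List (List ℕ)) →
  All (λ β → width (μ ⊕ β) ≡ w) (α ∷ αs) → width (veeP μ α αs) ≡ w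
veeP-width μ α []       (wα ∷ [])      = wα
veeP-width μ α (β ∷ βs) (wα ∷ wβ ∷ ws) =
  trans (∨-width (μ ⊕ β) (veeP μ α βs))
        (trans (cong₂ _⊔_ wβ (veeP-width μ α βs (wα ∷ ws))) (⊔-idem _))

veeP-widthBounded : ∀ (μ α : List ℕ) (αs : List (List ℕ)) →
  WidthBounded (μ ⊕ α) → WidthBounded (veeP μ α αs)
veeP-widthBounded μ α []       bα = bα
veeP-widthBounded μ α (β ∷ βs) _  = ∨-bounded (μ ⊕ β) (veeP μ α βs)

veeP-⊑ : ∀ {γ} (μ α : List ℕ) (αs : List (List ℕ)) →
  All (λ β → WidthBounded (μ ⊕ β)) (α ∷ αs) →
  veeP μ α αs ⊑ γ ⇔ All (λ β → (μ ⊕ β) ⊑ γ) (α ∷ αs)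
veeP-⊑ μ α []       _                = mk⇔ (_∷ []) All.head
veeP-⊑ {γ} μ α (β ∷ βs) (bα ∷ bβ ∷ bs) = mk⇔ forward backward
  where
  rec : veeP μ α βs ⊑ γ ⇔ All (λ β → (μ ⊕ β) ⊑ γ) (α ∷ βs)
  rec = veeP-⊑ {γ} μ α βs (bα ∷ bs)
  split : veeP μ α (β ∷ βs) ⊑ γ ⇔ ((μ ⊕ β) ⊑ γ × veeP μ α βs ⊑ γ)
  split = ∨-⊑ {γ = γ} bβ (veeP-widthBounded μ α βs bα)
  forward : veeP μ α (β ∷ βs) ⊑ γ → All (λ β → (μ ⊕ β) ⊑ γ) (α ∷ β ∷ βs)
  forward V⊑γ with Equivalence.to split V⊑γ
  ... | β⊑γ , V'⊑γ with Equivalence.to rec V'⊑γ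
  ...   | α⊑γ ∷ rest = α⊑γ ∷ β⊑γ ∷ rest
  backward : All (λ β → (μ ⊕ β) ⊑ γ) (α ∷ β ∷ βs) → veeP μ α (β ∷ βs) ⊑ γ
  backward (α⊑γ ∷ β⊑γ ∷ rest) = Equivalence.from split (β⊑γ , Equivalence.from rec (α⊑γ ∷ rest))

-- Lemma 2.5.  Every μ + β (β ∈ P) and ∨_P(μ) have width w_μ + k and are
-- bounded by it, so by InQ⇔ both sides say: γ is a partition with parts
-- in 1..w_μ+k containing the relevant lists as sub-multisets; veeP-⊑
-- identifies the two sub-multiset conditions.
lemma2p5 : (h k : ℕ) → 0 < h → 0 < k → (μ : List ℕ) → IsPartition μ →
    (α : List ℕ) (αs : List (List ℕ)) → All (InP h k) (α ∷ αs) →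
    (γ : List ℕ) →
    All (λ β → InQ (μ ⊕ β) γ) (α ∷ αs) ⇔ InQ (veeP μ α αs) γ
lemma2p5 h k _ _ μ pμ α αs inP γ = mk⇔ forward backward
  where
  summand-width : ∀ {β} → InP h k β → width (μ ⊕ β) ≡ width μ + k
  summand-width {β} (_ , _ , wβ≡k) = trans (⊕-width μ β) (cong (width μ +_) wβ≡k)
  bounds : All (λ β → WidthBounded (μ ⊕ β)) (α ∷ αs)
  bounds = All.map (λ (pβ , _) → ⊕-widthBounded pμ pβ) inP
  summand-Q : ∀ {β} → InP h k β → InQ (μ ⊕ β) γ ⇔ (IsPartition γ × (μ ⊕ β) ⊑ γ × Bounded (width μ + k) γ)
  summand-Q hβ@(pβ , _) = InQ⇔ (summand-width hβ) (⊕-widthBounded pμ pβ)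
  vee-Q : InQ (veeP μ α αs) γ ⇔ (IsPartition γ × veeP μ α αs ⊑ γ × Bounded (width μ + k) γ)
  vee-Q = InQ⇔ (veeP-width μ α αs (All.map summand-width inP)) (veeP-widthBounded μ α αs (All.head bounds))
  forward : All (λ β → InQ (μ ⊕ β) γ) (α ∷ αs) → InQ (veeP μ α αs) γ
  forward qs with Equivalence.to (summand-Q (All.head inP)) (All.head qs)
  ... | pγ , _ , bγ = Equivalence.from vee-Q (pγ , Equivalence.from (veeP-⊑ {γ} μ α αs bounds) sub , bγ)
    where
    sub : All (λ β → (μ ⊕ β) ⊑ γ) (α ∷ αs)
    sub = All.zipWith (λ (hβ , q) → proj₁ (proj₂ (Equivalence.to (summand-Q hβ) q))) (inP , qs)
  backward : InQ (veeP μ α αs) γ → All (λ β → InQ (μ ⊕ β) γ) (α ∷ αs)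
  backward q with Equivalence.to vee-Q q
  ... | pγ , V⊑γ , bγ = All.zipWith (λ (hβ , β⊑γ) → Equivalence.from (summand-Q hβ) (pγ , β⊑γ , bγ))
                                    (inP , Equivalence.to (veeP-⊑ {γ} μ α αs bounds) V⊑γ)
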